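{- Let $\mathcal{F}\subseteq\{0',1,{}^{ -1},{}^{c},\pi,\bar\pi,-,/,\backslash\}$ contain ${}^c$ or $-$, and let $k$ be a natural number. (1) If $\mathcal{F}$ contains $\pi$ and moreover either ${}^{ -1}\in\mathcal{F}$ or 1 is present at degree 0 in $\mathcal{C}(\mathcal{F})$, then, with $\mathcal{F}'=\mathcal{F}\setminus\{\pi\}$, two marked structures are $(\mathcal{F},k)$-bisimilar if and only if they are $(\mathcal{F}',k)$-bisimilar. (2) If $\mathcal{F}$ contains the left (respectively right) residual, contains ${}^{ -1}$, and 1 is present at degree 0 in $\mathcal{C}(\mathcal{F})$, then, with $\mathcal{F}'$ obtained from $\mathcal{F}$ by removing the left (respectively right) residual, two marked structures are $(\mathcal{F},k)$-bisimilar if and only if they are $(\mathcal{F}',k)$-bisimilar.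
   Context: Fix a finite set $\Lambda$ of relation names. A structure is $G=(V,(R^G)_{R\in\Lambda})$ with each $R^G\subseteq V\times V$; a marked structure is $(G,a,b)$ with $a,b\in V$. For $\mathcal{F}\subseteq\{0',1,{}^{ -1},{}^c,\pi,\bar\pi,-,/,\backslash\}$, $\mathcal{C}(\mathcal{F})$ is the set of expressions built from relation names, $0$ (empty relation), $1'$ (identity) and the constants in $\mathcal{F}$ ($1$ = all pairs $V^2$, $0'$ = pairs of distinct nodes) using composition $\circ$, union, intersection and the operations in $\mathcal{F}$: converse ${}^{ -1}$, complement ${}^c$ (relative to $V^2$), difference $-$, projections $\pi_1(e)=\{(s,s):\exists t\,(s,t)\in e\}$, $\pi_2(e)=\{(s,s):\exists t\,(t,s)\in e\}$ (both denoted $\pi$), coprojections $\bar\pi_1,\bar\pi_2$ (the identity pairs not in the corresponding projection; both denoted $\bar\pi$), left residual $(e_1/e_2)=\{(s,t):\forall v((t,v)\in e_2\to(s,v)\in e_1)\}$ and right residual $(e_1\backslash e_2)=\{(s,t):\forall v((v,s)\in e_1\to(v,t)\in e_2)\}$. $\mathrm{paths}^{\mathcal{F}}_k(G)$: let $E_G=\bigcup_R R^G$; $\mathrm{paths}_k(G)$ = pairs $(x,y)\in V^2$ joined by a directed path of length $\le 2^k$ in $(V,E_G)$ (length $0$ allowed), $\mathrm{upaths}_k(G)$ = same in the undirected version. 1 is present at degree 0 if $\mathcal{F}$ contains $1,0'$ or ${}^c$; at degree 1 if not at degree 0 and $\mathcal{F}$ contains $/$ or $\backslash$; absent otherwise.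 If absent: $\mathrm{paths}^{\mathcal{F}}_k(G)=\mathrm{paths}_k(G)$ if ${}^{ -1}\notin\mathcal{F}$, $=\mathrm{upaths}_k(G)$ if ${}^{ -1}\in\mathcal{F}$; if at degree 1: as in the absent case for $k=0$, $V^2$ for $k>0$; if at degree 0: $V^2$. Atomic expressions $1',0',R,R^{ -1}$; $\mathrm{aexp}(\mathcal{F})$ those in $\mathcal{C}(\mathcal{F})$; $\mathrm{atp}^{\mathcal{F}}(G,a,b)=\{e\in\mathrm{aexp}(\mathcal{F}):(a,b)\in e(G)\}$. For $Z\subseteq V_1^2\times V_2^2$, $i>0$, $P_j=\mathrm{paths}^{\mathcal{F}}_{i-1}(G_j)$, a tuple $(a_1,b_1,a_2,b_2)$ has: Atoms Forth/Back if $\mathrm{atp}^{\mathcal{F}}(G_1,a_1,b_1)\subseteq$ / $\supseteq\mathrm{atp}^{\mathcal{F}}(G_2,a_2,b_2)$; Composition Forth (w.r.t. $Z$) if every $c_1$ with $(a_1,c_1),(c_1,b_1)\in P_1$ has $c_2$ with $(a_1,c_1,a_2,c_2),(c_1,b_1,c_2,b_2)\in Z$; Composition Back symmetrically; Projection Forth if $a_1\ne b_1$, or $a_1=b_1$, $a_2=b_2$ and every $c_1$ with $(a_1,c_1)\in P_1$ has $c_2$ with $(a_1,c_1,a_2,c_2)\in Z$, and moreover if $a_1=b_1$ every $c_1$ with $(c_1,a_1)\in P_1$ has $c_2$ with $(c_1,a_1,c_2,a_2)\in Z$; Projection Back the same with indices $1,2$ swapped; Left Residual Forth: every $c_2$ with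 $(b_2,c_2)\in P_2$ has $c_1$ with $(b_1,c_1,b_2,c_2)\in Z$ and ($(a_1,c_1)\notin P_1$ or $(a_1,c_1,a_2,c_2)\in Z$); Left Residual Back: every $c_1$ with $(b_1,c_1)\in P_1$ has $c_2$ with $(b_1,c_1,b_2,c_2)\in Z$ and ($(a_2,c_2)\notin P_2$ or $(a_1,c_1,a_2,c_2)\in Z$); Right Residual Forth: every $c_2$ with $(c_2,a_2)\in P_2$ has $c_1$ with $(c_1,a_1,c_2,a_2)\in Z$ and ($(c_1,b_1)\notin P_1$ or $(c_1,b_1,c_2,b_2)\in Z$); Right Residual Back: every $c_1$ with $(c_1,a_1)\in P_1$ has $c_2$ with $(c_1,a_1,c_2,a_2)\in Z$ and ($(c_2,b_2)\notin P_2$ or $(c_1,b_1,c_2,b_2)\in Z$). An $(\mathcal{F},k)$-bisimulation from $G_1$ to $G_2$ is a decreasing sequence $Z_0\supseteq\dots\supseteq Z_k$ of subsets of $V_1^2\times V_2^2$ such that elements of $Z_0$ have Atoms Forth and Back and, for $1\le i\le k$, elements of $Z_i$ have at degree $i$ w.r.t. $Z_{i-1}$: Composition Forth and Back; Projection Forth and Back if $\pi\in\mathcal{F}$; Left (Right) Residual Forth and Back if $/$ ($\backslash$) $\in\mathcal{F}$. $(G_1,a_1,b_1)$, $(G_2,a_2,b_2)$ are $(\mathcal{F},k)$-bisimilar if such a sequence exists with $(a_1,b_1,a_2,b_2)\in Z_k$. -}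

module Defs where

open import Data.Nat using (ℕ; zero; suc; _^_; _<_; _≡ᵇ_)
open import Data.Fin using (Fin)
open import Data.Bool using (Bool; true; false; if_then_else_; _∨_; T)
open import Data.Product using (Σ; _×_; _,_)
open import Data.Sum using (_⊎_)
open import Data.Unit using (⊤)
open import Relation.Nullary using (¬_)
open import Relation.Binary.PropositionalEquality using (_≡_)

data Op : Set where
  zero' one inv compl proj coproj minus lres rres : Op

code : Op → ℕ
code zero'  = 0
code one    = 1
code inv    = 2
code compl  = 3
code proj   = 4
code coproj = 5
code minus  = 6
code lres   = 7
code rres   = 8

Fragment : Set
Fragment = Op → Bool

_∈F_ : Op → Fragment → Set
o ∈F F = T (F o)

remove : Op → Fragment → Fragment
remove o F o' = if code o ≡ᵇ code o' then false else F o'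

-- Presence of the constant 1 in 𝓒(𝓕)
data OnePresence : Set where
  deg0 deg1 absent : OnePresence

onePresence : Fragment → OnePresence
onePresence F =
  if F one ∨ F zero' ∨ F compl then deg0
  else (if F lres ∨ F rres then deg1 else absent)

OneAtDeg0 : Fragment → Set
OneAtDeg0 F = onePresence F ≡ deg0

record Structure (n : ℕ) : Set₁ where
  field
    V   : Set
    rel : Fin n → V → V → Set
open Structure public

Edge : ∀ {n} (G : Structure n) → V G → V G → Set
Edge {n} G x y = Σ (Fin n) λ r → rel G r x y

UEdge : ∀ {n} (G : Structure n) → V G → V G → Set
UEdge G x y = Edge G x y ⊎ Edge G y x

data Within {A : Set} (E : A → A → Set) : ℕ → A → A → Set where
  here : ∀ {m x} → Within E m x x
  step : ∀ {m x z y} → E x z → Within E m z y → Within E (suc m) x y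

paths : ∀ {n} (G : Structure n) → ℕ → V G → V G → Set
paths G k = Within (Edge G) (2 ^ k)

upaths : ∀ {n} (G : Structure n) → ℕ → V G → V G → Set
upaths G k = Within (UEdge G) (2 ^ k)

pathsAbsent : ∀ {n} → Fragment → (G : Structure n) → ℕ → V G → V G → Set
pathsAbsent F G k x y = if F inv then upaths G k x y else paths G k x y

pathsDeg1 : ∀ {n} → Fragment → (G : Structure n) → ℕ → V G → V G → Set
pathsDeg1 F G zero    x y = pathsAbsent F G zero x y
pathsDeg1 F G (suc k) x y = ⊤

pathsAt : ∀ {n} → OnePresence → Fragment → (G : Structure n) → ℕ → V G → V G → Set
pathsAt deg0   F G k x y = ⊤
pathsAt deg1   F G k x y = pathsDeg1 F G k x y
pathsAt absent F G k x y = pathsAbsent F G k x y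

pathsF : ∀ {n} → Fragment → (G : Structure n) → ℕ → V G → V G → Set
pathsF F G k = pathsAt (onePresence F) F G k

data Atom (n : ℕ) : Set where
  idA   : Atom n
  divA  : Atom n
  relA  : Fin n → Atom n
  convA : Fin n → Atom n

InAexp : ∀ {n} → Fragment → Atom n → Set
InAexp F idA       = ⊤
InAexp F divA      = zero' ∈F F
InAexp F (relA r)  = ⊤
InAexp F (convA r) = inv ∈F F

Holds : ∀ {n} (G : Structure n) → Atom n → V G → V G → Set
Holds G idA       a b = a ≡ b
Holds G divA      a b = ¬ (a ≡ b)
Holds G (relA r)  a b = rel G r a b
Holds G (convA r) a b = rel G r b a

module _ {n : ℕ} (F : Fragment) (G₁ G₂ : Structure n) where

  private
    V₁ = V G₁
    V₂ = V G₂

  Rel4 : Set₁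
  Rel4 = V₁ → V₁ → V₂ → V₂ → Set

  AtomsForth : V₁ → V₁ → V₂ → V₂ → Set
  AtomsForth a₁ b₁ a₂ b₂ =
    (e : Atom n) → InAexp F e → Holds G₁ e a₁ b₁ → Holds G₂ e a₂ b₂

  AtomsBack : V₁ → V₁ → V₂ → V₂ → Set
  AtomsBack a₁ b₁ a₂ b₂ =
    (e : Atom n) → InAexp F e → Holds G₂ e a₂ b₂ → Holds G₁ e a₁ b₁

  -- conditions at degree (suc j), w.r.t. Z, with P_i = paths^𝓕_j(G_i)
  module Conds (j : ℕ) (Z : Rel4) (a₁ b₁ : V₁) (a₂ b₂ : V₂) where
    P₁ = pathsF F G₁ j
    P₂ = pathsF F G₂ j

    CompForth : Set
    CompForth = (c₁ : V₁) → P₁ a₁ c₁ → P₁ c₁ b₁ →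
      Σ V₂ λ c₂ → Z a₁ c₁ a₂ c₂ × Z c₁ b₁ c₂ b₂

    CompBack : Set
    CompBack = (c₂ : V₂) → P₂ a₂ c₂ → P₂ c₂ b₂ →
      Σ V₁ λ c₁ → Z a₁ c₁ a₂ c₂ × Z c₁ b₁ c₂ b₂

    ProjForth : Set
    ProjForth = a₁ ≡ b₁ →
      (a₂ ≡ b₂)
      × ((c₁ : V₁) → P₁ a₁ c₁ → Σ V₂ λ c₂ → Z a₁ c₁ a₂ c₂)
      × ((c₁ : V₁) → P₁ c₁ a₁ → Σ V₂ λ c₂ → Z c₁ a₁ c₂ a₂)

    ProjBack : Set
    ProjBack = a₂ ≡ b₂ →
      (a₁ ≡ b₁)
      × ((c₂ : V₂) → P₂ a₂ c₂ → Σ V₁ λ c₁ → Z a₁ c₁ a₂ c₂)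
      × ((c₂ : V₂) → P₂ c₂ a₂ → Σ V₁ λ c₁ → Z c₁ a₁ c₂ a₂)

    LResForth : Set
    LResForth = (c₂ : V₂) → P₂ b₂ c₂ →
      Σ V₁ λ c₁ → Z b₁ c₁ b₂ c₂ × (P₁ a₁ c₁ → Z a₁ c₁ a₂ c₂)

    LResBack : Set
    LResBack = (c₁ : V₁) → P₁ b₁ c₁ →
      Σ V₂ λ c₂ → Z b₁ c₁ b₂ c₂ × (P₂ a₂ c₂ → Z a₁ c₁ a₂ c₂)

    RResForth : Set
    RResForth = (c₂ : V₂) → P₂ c₂ a₂ →
      Σ V₁ λ c₁ → Z c₁ a₁ c₂ a₂ × (P₁ c₁ b₁ → Z c₁ b₁ c₂ b₂)

    RResBack : Set
    RResBack = (c₁ : V₁) → P₁ c₁ a₁ →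
      Σ V₂ λ c₂ → Z c₁ a₁ c₂ a₂ × (P₂ c₂ b₂ → Z c₁ b₁ c₂ b₂)

    StepConds : Set
    StepConds =
      CompForth × CompBack
      × (proj ∈F F → ProjForth × ProjBack)
      × (lres ∈F F → LResForth × LResBack)
      × (rres ∈F F → RResForth × RResBack)

  -- (𝓕,k)-bisimulation Z₀ ⊇ Z₁ ⊇ … ⊇ Z_k  (Z i for i > k is irrelevant)
  IsBisimulation : ℕ → (ℕ → Rel4) → Set
  IsBisimulation k Z =
    (∀ i → i < k → ∀ a₁ b₁ a₂ b₂ → Z (suc i) a₁ b₁ a₂ b₂ → Z i a₁ b₁ a₂ b₂)
    × (∀ a₁ b₁ a₂ b₂ → Z 0 a₁ b₁ a₂ b₂ →
         AtomsForth a₁ b₁ a₂ b₂ × AtomsBack a₁ b₁ a₂ b₂)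
    × (∀ i → i < k → ∀ a₁ b₁ a₂ b₂ → Z (suc i) a₁ b₁ a₂ b₂ →
         Conds.StepConds i (Z i) a₁ b₁ a₂ b₂)

Bisimilar : ∀ {n} → Fragment → ℕ →
  (G₁ : Structure n) → V G₁ → V G₁ → (G₂ : Structure n) → V G₂ → V G₂ → Set₁
Bisimilar F k G₁ a₁ b₁ G₂ a₂ b₂ =
  Σ (ℕ → Rel4 F G₁ G₂) λ Z → IsBisimulation F G₁ G₂ k Z × Z k a₁ b₁ a₂ b₂

SameBisim : ℕ → Fragment → Fragment → ℕ → Set₁
SameBisim n F F' k =
  (G₁ : Structure n) (a₁ b₁ : V G₁) (G₂ : Structure n) (a₂ b₂ : V G₂) →
  (Bisimilar F k G₁ a₁ b₁ G₂ a₂ b₂ → Bisimilar F' k G₁ a₁ b₁ G₂ a₂ b₂)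
  × (Bisimilar F' k G₁ a₁ b₁ G₂ a₂ b₂ → Bisimilar F k G₁ a₁ b₁ G₂ a₂ b₂)

-- When paths are symmetric (⁻¹ present, or 1 at degree 0), the projection conditions at a
-- loop (a, a) are instances of the composition conditions, the intermediate node being
-- reached along a path and back; hence a relation is an (𝓕,k)-bisimulation iff it is one
-- for 𝓕 ∖ {π}. When ⁻¹ is present and 1 is at degree 0, all pairs of nodes are path
-- related. Closing a bisimulation under swapping the two coordinates on both sides then
-- preserves the atom conditions (R and R⁻¹ trade places), and its composition witnesses,
-- with one factor swapped, are exactly residual witnesses. So the closure is a
-- bisimulation for every fragment with the same atomic expressions: bisimilarity then
-- depends only on whether 0' is present.

module Submission where

open import Defs
open import Data.Bool using (true; false; T; _∨_; if_then_else_)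
open import Data.Nat using (ℕ; zero; suc; _≤_; _<_)
open import Data.Nat.Properties using (<⇒≤)
open import Data.Product using (Σ; _×_; _,_; proj₁; proj₂; map; map₁; map₂)
open import Data.Sum as Sum using (_⊎_; inj₁; inj₂)
open import Data.Unit using (tt)
open import Function using (id; _∘_)
open import Function.Bundles using (_⇔_; mk⇔; Equivalence)
open import Relation.Binary.PropositionalEquality using (_≡_; refl; sym; subst; ≢-sym)

open Equivalence using (to; from)

Within-snoc : ∀ {A : Set} {E : A → A → Set} {m x y z} →
  Within E m x y → E y z → Within E (suc m) x z
Within-snoc here       e′ = step e′ here
Within-snoc (step e p) e′ = step e (Within-snoc p e′)

Within-reverse : ∀ {A : Set} {E : A → A → Set} → (∀ {x y} → E x y → E y x) →
  ∀ {m x y} → Within E m x y → Within E m y x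
Within-reverse E-sym here       = here
Within-reverse E-sym (step e p) = Within-snoc (Within-reverse E-sym p) (E-sym e)

UEdge-sym : ∀ {n} {G : Structure n} {x y} → UEdge G x y → UEdge G y x
UEdge-sym = Sum.swap

SymmetricPaths : Fragment → Set₁
SymmetricPaths F = ∀ {n} (G : Structure n) j {x y} → pathsF F G j x y → pathsF F G j y x

PathsSubset : Fragment → Fragment → Set₁
PathsSubset F F′ = ∀ {n} (G : Structure n) j {x y} → pathsF F G j x y → pathsF F′ G j x y

oneAtDeg0-intro : ∀ F → T (F one ∨ F zero' ∨ F compl) → OneAtDeg0 F
oneAtDeg0-intro F h with F one ∨ F zero' ∨ F compl
... | true = refl

oneAtDeg0-elim : ∀ F → OneAtDeg0 F → T (F one ∨ F zero' ∨ F compl)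
oneAtDeg0-elim F h with F one ∨ F zero' ∨ F compl | F lres ∨ F rres
oneAtDeg0-elim F h  | true  | _     = tt
oneAtDeg0-elim F () | false | true
oneAtDeg0-elim F () | false | false

pathsF-total : ∀ F → OneAtDeg0 F → ∀ {n} (G : Structure n) j {x y} → pathsF F G j x y
pathsF-total F h G j rewrite h = tt

pathsAbsent-sym : ∀ {n} F {G : Structure n} → inv ∈F F → ∀ j {x y} →
  pathsAbsent F G j x y → pathsAbsent F G j y x
pathsAbsent-sym F {G} inv∈F j with F inv
... | true = Within-reverse (UEdge-sym {G = G})

pathsAt-sym : ∀ {n} F {G : Structure n} → inv ∈F F → ∀ o j {x y} →
  pathsAt o F G j x y → pathsAt o F G j y x
pathsAt-sym F inv∈F deg0   j       _ = tt
pathsAt-sym F inv∈F deg1   zero    p = pathsAbsent-sym F inv∈F zero p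
pathsAt-sym F inv∈F deg1   (suc j) _ = tt
pathsAt-sym F inv∈F absent j       p = pathsAbsent-sym F inv∈F j p

pathsF-sym : ∀ F → inv ∈F F ⊎ OneAtDeg0 F → SymmetricPaths F
pathsF-sym F (inj₁ inv∈F) G j   = pathsAt-sym F inv∈F (onePresence F) j
pathsF-sym F (inj₂ h)     G j _ = pathsF-total F h G j

pathsAbsent-cong : ∀ {n} F F′ {G : Structure n} → F inv ≡ F′ inv → ∀ j {x y} →
  pathsAbsent F G j x y → pathsAbsent F′ G j x y
pathsAbsent-cong F F′ {G} eq j {x} {y} =
  subst (λ b → if b then upaths G j x y else paths G j x y) eq

pathsAt-cong : ∀ {n} F F′ {G : Structure n} → F inv ≡ F′ inv → ∀ o j {x y} →
  pathsAt o F G j x y → pathsAt o F′ G j x y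
pathsAt-cong F F′ eq deg0   j       _ = tt
pathsAt-cong F F′ eq deg1   zero    p = pathsAbsent-cong F F′ eq zero p
pathsAt-cong F F′ eq deg1   (suc j) _ = tt
pathsAt-cong F F′ eq absent j       p = pathsAbsent-cong F F′ eq j p

pathsF-cong : ∀ F F′ → onePresence F ≡ onePresence F′ → F inv ≡ F′ inv → PathsSubset F F′
pathsF-cong F F′ eq-one eq-inv G j {x} {y} p =
  pathsAt-cong F F′ eq-inv (onePresence F′) j (subst (λ o → pathsAt o F G j x y) eq-one p)

AexpSubset : Fragment → Fragment → Set
AexpSubset F F′ = ∀ {n} (e : Atom n) → InAexp F e → InAexp F′ e

aexpSubset : ∀ {F F′} → (zero' ∈F F → zero' ∈F F′) → (inv ∈F F → inv ∈F F′) → AexpSubset F F′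
aexpSubset sub₀ sub₁ idA       _ = tt
aexpSubset sub₀ sub₁ divA        = sub₀
aexpSubset sub₀ sub₁ (relA r)  _ = tt
aexpSubset sub₀ sub₁ (convA r)   = sub₁

module _ {n} {F F′ : Fragment} {G₁ G₂ : Structure n} {a₁ b₁ : V G₁} {a₂ b₂ : V G₂} where

  atomsForth-restrict : AexpSubset F′ F →
    AtomsForth F G₁ G₂ a₁ b₁ a₂ b₂ → AtomsForth F′ G₁ G₂ a₁ b₁ a₂ b₂
  atomsForth-restrict sub h e e∈F′ = h e (sub e e∈F′)

  atomsForth-flip : inv ∈F F → AexpSubset F′ F →
    AtomsForth F G₁ G₂ b₁ a₁ b₂ a₂ → AtomsForth F′ G₁ G₂ a₁ b₁ a₂ b₂
  atomsForth-flip inv∈F sub h idA       _    eq = sym (h idA tt (sym eq))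
  atomsForth-flip inv∈F sub h divA      e∈F′ ne = h divA (sub {n} divA e∈F′) (≢-sym ne) ∘ sym
  atomsForth-flip inv∈F sub h (relA r)  _    r₁ = h (convA r) inv∈F r₁
  atomsForth-flip inv∈F sub h (convA r) _    r₁ = h (relA r) tt r₁

-- A Back condition is the Forth condition for the swapped structures and the transposed
-- relation, so only Forth versions are proved and Back ones are their instances at transpose Z.
transpose : ∀ {A B : Set} → (A → A → B → B → Set) → B → B → A → A → Set
transpose Z a₂ b₂ a₁ b₁ = Z a₁ b₁ a₂ b₂

module Restrict {n} (F F′ : Fragment) {G₁ G₂ : Structure n} {j : ℕ}
  (sub₁ : ∀ {x y} → pathsF F′ G₁ j x y → pathsF F G₁ j x y)
  (sub₂ : ∀ {x y} → pathsF F′ G₂ j x y → pathsF F G₂ j x y)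
  (Z : V G₁ → V G₁ → V G₂ → V G₂ → Set) (a₁ b₁ : V G₁) (a₂ b₂ : V G₂) where

  private
    module C  = Conds F  G₁ G₂ j Z a₁ b₁ a₂ b₂
    module C′ = Conds F′ G₁ G₂ j Z a₁ b₁ a₂ b₂

  compForth : C.CompForth → C′.CompForth
  compForth comp c₁ p q = comp c₁ (sub₁ p) (sub₁ q)

  lresForth : C.LResForth → C′.LResForth
  lresForth cond c₂ p = map₂ (map₂ (_∘ sub₁)) (cond c₂ (sub₂ p))

  rresForth : C.RResForth → C′.RResForth
  rresForth cond c₂ p = map₂ (map₂ (_∘ sub₁)) (cond c₂ (sub₂ p))

projForth-of-compForth : ∀ {n F} {G₁ G₂ : Structure n} {j Z a₁ b₁ a₂ b₂} →
  (∀ {x y} → pathsF F G₁ j x y → pathsF F G₁ j y x) → (a₁ ≡ b₁ → a₂ ≡ b₂) →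
  Conds.CompForth F G₁ G₂ j Z a₁ b₁ a₂ b₂ → Conds.ProjForth F G₁ G₂ j Z a₁ b₁ a₂ b₂
projForth-of-compForth sym₁ same comp refl with same refl
... | refl = refl , (λ c₁ p → map₂ proj₁ (comp c₁ p (sym₁ p)))
                  , (λ c₁ p → map₂ proj₂ (comp c₁ (sym₁ p) p))

module _ {n} {F : Fragment} {G₁ G₂ : Structure n} {k} {Z : ℕ → Rel4 F G₁ G₂}
  (B : IsBisimulation F G₁ G₂ k Z) where

  descend : ∀ {i} → i ≤ k → ∀ {a₁ b₁ a₂ b₂} → Z i a₁ b₁ a₂ b₂ → Z 0 a₁ b₁ a₂ b₂
  descend {zero}  _   z = z
  descend {suc i} i<k z = descend (<⇒≤ i<k) (proj₁ B i i<k _ _ _ _ z)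

  identity-agrees : ∀ {i} → i ≤ k → ∀ {a₁ b₁ a₂ b₂} → Z i a₁ b₁ a₂ b₂ → (a₁ ≡ b₁ ⇔ a₂ ≡ b₂)
  identity-agrees i≤k z with proj₁ (proj₂ B) _ _ _ _ (descend i≤k z)
  ... | forth , back = mk⇔ (forth idA tt) (back idA tt)

stepConds-transfer : ∀ {n} (F F′ : Fragment) {G₁ G₂ : Structure n} j (Z : Rel4 F G₁ G₂) →
  ∀ {a₁ b₁ a₂ b₂} →
  (∀ {x y} → pathsF F′ G₁ j x y → pathsF F G₁ j x y) →
  (∀ {x y} → pathsF F′ G₂ j x y → pathsF F G₂ j x y) →
  (∀ {x y} → pathsF F′ G₁ j x y → pathsF F′ G₁ j y x) →
  (∀ {x y} → pathsF F′ G₂ j x y → pathsF F′ G₂ j y x) →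
  (a₁ ≡ b₁ ⇔ a₂ ≡ b₂) → (lres ∈F F′ → lres ∈F F) → (rres ∈F F′ → rres ∈F F) →
  Conds.StepConds F G₁ G₂ j Z a₁ b₁ a₂ b₂ → Conds.StepConds F′ G₁ G₂ j Z a₁ b₁ a₂ b₂
stepConds-transfer F F′ {G₁} {G₂} j Z {a₁} {b₁} {a₂} {b₂} sub₁ sub₂ sym₁ sym₂ same lres⊆ rres⊆
                   (compF , compB , _ , lresFB , rresFB) =
  compF′ , compB′ ,
  (λ _ → projForth-of-compForth {F = F′} {G₁} {G₂} {j} {Z} sym₁ (to same) compF′
       , projForth-of-compForth {F = F′} {G₂} {G₁} {j} {transpose Z} sym₂ (from same) compB′) ,
  (λ h → map R.lresForth Rᵀ.lresForth (lresFB (lres⊆ h))) ,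
  (λ h → map R.rresForth Rᵀ.rresForth (rresFB (rres⊆ h)))
  where
  module R  = Restrict F F′ sub₁ sub₂ Z a₁ b₁ a₂ b₂
  module Rᵀ = Restrict F F′ sub₂ sub₁ (transpose Z) a₂ b₂ a₁ b₁
  compF′ = R.compForth compF
  compB′ = Rᵀ.compForth compB

isBisimulation-transfer : ∀ {n F F′ k} {G₁ G₂ : Structure n} {Z : ℕ → Rel4 F G₁ G₂} →
  AexpSubset F′ F → PathsSubset F′ F → SymmetricPaths F′ →
  (lres ∈F F′ → lres ∈F F) → (rres ∈F F′ → rres ∈F F) →
  IsBisimulation F G₁ G₂ k Z → IsBisimulation F′ G₁ G₂ k Z
isBisimulation-transfer {F = F} {F′} {G₁ = G₁} {G₂} {Z} aexp paths sym′ lres⊆ rres⊆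
                        B@(descending , atoms , steps) =
  descending ,
  (λ a₁ b₁ a₂ b₂ z →
     map (atomsForth-restrict aexp) (atomsForth-restrict aexp) (atoms a₁ b₁ a₂ b₂ z)) ,
  λ i i<k a₁ b₁ a₂ b₂ z →
    stepConds-transfer F F′ i (Z i) (paths G₁ i) (paths G₂ i) (sym′ G₁ i) (sym′ G₂ i)
                       (identity-agrees B i<k z) lres⊆ rres⊆ (steps i i<k a₁ b₁ a₂ b₂ z)

sameBisim-remove-proj : ∀ {n F k} → inv ∈F F ⊎ OneAtDeg0 F → SameBisim n F (remove proj F) k
sameBisim-remove-proj {F = F} symmetric _ _ _ _ _ _ =
  map₂ (map₁ (isBisimulation-transfer {F = F} {F′}
                (aexpSubset id id) (pathsF-cong F′ F refl refl) (pathsF-sym F′ symmetric) id id)) ,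
  map₂ (map₁ (isBisimulation-transfer {F = F′} {F}
                (aexpSubset id id) (pathsF-cong F F′ refl refl) (pathsF-sym F symmetric) id id))
  where
  F′ = remove proj F

FlipClosure : ∀ {A B : Set} → (A → A → B → B → Set) → A → A → B → B → Set
FlipClosure Z a₁ b₁ a₂ b₂ = Z a₁ b₁ a₂ b₂ ⊎ Z b₁ a₁ b₂ a₂

Composable : ∀ {A B : Set} → (A → A → B → B → Set) → A → A → B → B → Set
Composable {A} {B} Z a₁ b₁ a₂ b₂ = (c₁ : A) → Σ B λ c₂ → Z a₁ c₁ a₂ c₂ × Z c₁ b₁ c₂ b₂

BiComposable : ∀ {A B : Set} → (A → A → B → B → Set) → A → A → B → B → Set
BiComposable Z a₁ b₁ a₂ b₂ = Composable Z a₁ b₁ a₂ b₂ × Composable (transpose Z) a₂ b₂ a₁ b₁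

module _ {A B : Set} {Z : A → A → B → B → Set} {a₁ b₁ : A} {a₂ b₂ : B} where

  composable-inj₁ : Composable Z a₁ b₁ a₂ b₂ → Composable (FlipClosure Z) a₁ b₁ a₂ b₂
  composable-inj₁ comp c₁ = map₂ (map inj₁ inj₁) (comp c₁)

  composable-inj₂ : Composable Z b₁ a₁ b₂ a₂ → Composable (FlipClosure Z) a₁ b₁ a₂ b₂
  composable-inj₂ comp c₁ = map₂ (λ (z₁ , z₂) → inj₂ z₂ , inj₂ z₁) (comp c₁)

module FromComposable {n} (F : Fragment) {G₁ G₂ : Structure n} (j : ℕ)
  (Z : V G₁ → V G₁ → V G₂ → V G₂ → Set)
  (Z-flip : ∀ {a₁ b₁ a₂ b₂} → Z a₁ b₁ a₂ b₂ → Z b₁ a₁ b₂ a₂) where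

  projForth : ∀ {a₁ b₁ a₂ b₂} → (a₁ ≡ b₁ → a₂ ≡ b₂) →
    Composable Z a₁ b₁ a₂ b₂ → Conds.ProjForth F G₁ G₂ j Z a₁ b₁ a₂ b₂
  projForth same comp refl with same refl
  ... | refl = refl , (λ c₁ _ → map₂ proj₁ (comp c₁)) , (λ c₁ _ → map₂ proj₂ (comp c₁))

  lresForth : ∀ {a₁ b₁ a₂ b₂} →
    Composable (transpose Z) a₂ b₂ a₁ b₁ → Conds.LResForth F G₁ G₂ j Z a₁ b₁ a₂ b₂
  lresForth comp c₂ _ = map₂ (λ (z₁ , z₂) → Z-flip z₂ , λ _ → z₁) (comp c₂)

  rresForth : ∀ {a₁ b₁ a₂ b₂} →
    Composable (transpose Z) a₂ b₂ a₁ b₁ → Conds.RResForth F G₁ G₂ j Z a₁ b₁ a₂ b₂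
  rresForth comp c₂ _ = map₂ (λ (z₁ , z₂) → Z-flip z₁ , λ _ → z₂) (comp c₂)

stepConds-of-composable : ∀ {n} (F : Fragment) {G₁ G₂ : Structure n} (j : ℕ)
  (Z : V G₁ → V G₁ → V G₂ → V G₂ → Set) → (∀ {a₁ b₁ a₂ b₂} → Z a₁ b₁ a₂ b₂ → Z b₁ a₁ b₂ a₂) →
  ∀ {a₁ b₁ a₂ b₂} → (a₁ ≡ b₁ ⇔ a₂ ≡ b₂) → BiComposable Z a₁ b₁ a₂ b₂ →
  Conds.StepConds F G₁ G₂ j Z a₁ b₁ a₂ b₂
stepConds-of-composable F j Z Z-flip same (forth , back) =
  (λ c₁ _ _ → forth c₁) , (λ c₂ _ _ → back c₂) ,
  (λ _ → M.projForth (to same) forth , Mᵀ.projForth (from same) back) ,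
  (λ _ → M.lresForth back , Mᵀ.lresForth forth) ,
  (λ _ → M.rresForth back , Mᵀ.rresForth forth)
  where
  module M  = FromComposable F j Z Z-flip
  module Mᵀ = FromComposable F j (transpose Z) Z-flip

≡-flip-⇔ : ∀ {A B : Set} {a₁ b₁ : A} {a₂ b₂ : B} → (b₁ ≡ a₁ ⇔ b₂ ≡ a₂) → (a₁ ≡ b₁ ⇔ a₂ ≡ b₂)
≡-flip-⇔ e = mk⇔ (λ eq → sym (to e (sym eq))) (λ eq → sym (from e (sym eq)))

isBisimulation-flipClosure : ∀ {n F F′ k} {G₁ G₂ : Structure n} {Z : ℕ → Rel4 F G₁ G₂} →
  inv ∈F F → OneAtDeg0 F → AexpSubset F′ F →
  IsBisimulation F G₁ G₂ k Z → IsBisimulation F′ G₁ G₂ k (λ i → FlipClosure (Z i))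
isBisimulation-flipClosure {n} {F} {F′} {k} {G₁} {G₂} {Z} inv∈F total aexp
                           B@(descending , atoms , steps) =
  (λ i i<k a₁ b₁ a₂ b₂ → Sum.map (descending i i<k a₁ b₁ a₂ b₂) (descending i i<k b₁ a₁ b₂ a₂)) ,
  atoms′ ,
  λ i i<k a₁ b₁ a₂ b₂ z →
    stepConds-of-composable F′ i (FlipClosure (Z i)) Sum.swap (agrees i<k z) (composable i<k z)
  where
  atoms′ : ∀ a₁ b₁ a₂ b₂ → FlipClosure (Z 0) a₁ b₁ a₂ b₂ →
    AtomsForth F′ G₁ G₂ a₁ b₁ a₂ b₂ × AtomsBack F′ G₁ G₂ a₁ b₁ a₂ b₂
  atoms′ a₁ b₁ a₂ b₂ (inj₁ z) =
    map (atomsForth-restrict aexp) (atomsForth-restrict aexp) (atoms a₁ b₁ a₂ b₂ z)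
  atoms′ a₁ b₁ a₂ b₂ (inj₂ z) =
    map (atomsForth-flip inv∈F aexp) (atomsForth-flip inv∈F aexp) (atoms b₁ a₁ b₂ a₂ z)

  agrees : ∀ {i} → i < k → ∀ {a₁ b₁ a₂ b₂} → FlipClosure (Z (suc i)) a₁ b₁ a₂ b₂ →
    (a₁ ≡ b₁ ⇔ a₂ ≡ b₂)
  agrees i<k (inj₁ z) = identity-agrees B i<k z
  agrees i<k (inj₂ z) = ≡-flip-⇔ (identity-agrees B i<k z)

  composableZ : ∀ {i} → i < k → ∀ {a₁ b₁ a₂ b₂} → Z (suc i) a₁ b₁ a₂ b₂ →
    BiComposable (Z i) a₁ b₁ a₂ b₂
  composableZ {i} i<k z with steps i i<k _ _ _ _ z
  ... | compF , compB , _ =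
    (λ c₁ → compF c₁ (all G₁) (all G₁)) , (λ c₂ → compB c₂ (all G₂) (all G₂))
    where
    all : ∀ (G : Structure n) {x y} → pathsF F G i x y
    all G = pathsF-total F total G i

  composable : ∀ {i} → i < k → ∀ {a₁ b₁ a₂ b₂} → FlipClosure (Z (suc i)) a₁ b₁ a₂ b₂ →
    BiComposable (FlipClosure (Z i)) a₁ b₁ a₂ b₂
  composable {i} i<k (inj₁ z) =
    map (composable-inj₁ {Z = Z i}) (composable-inj₁ {Z = transpose (Z i)}) (composableZ i<k z)
  composable {i} i<k (inj₂ z) =
    map (composable-inj₂ {Z = Z i}) (composable-inj₂ {Z = transpose (Z i)}) (composableZ i<k z)

bisimilar-flipClosure : ∀ {n F F′ k} {G₁ : Structure n} {a₁ b₁} {G₂ : Structure n} {a₂ b₂} →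
  inv ∈F F → OneAtDeg0 F → AexpSubset F′ F →
  Bisimilar F k G₁ a₁ b₁ G₂ a₂ b₂ → Bisimilar F′ k G₁ a₁ b₁ G₂ a₂ b₂
bisimilar-flipClosure inv∈F total aexp (Z , B , z) =
  (λ i → FlipClosure (Z i)) , isBisimulation-flipClosure inv∈F total aexp B , inj₁ z

sameBisim-of-inv-oneAtDeg0 : ∀ {n F F′ k} → inv ∈F F → inv ∈F F′ → OneAtDeg0 F → OneAtDeg0 F′ →
  (zero' ∈F F ⇔ zero' ∈F F′) → SameBisim n F F′ k
sameBisim-of-inv-oneAtDeg0 {F = F} {F′} inv∈F inv∈F′ total total′ same₀ _ _ _ _ _ _ =
  bisimilar-flipClosure {F = F} inv∈F total (aexpSubset {F′} (from same₀) (λ _ → inv∈F)) ,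
  bisimilar-flipClosure {F = F′} inv∈F′ total′ (aexpSubset {F} (to same₀) (λ _ → inv∈F′))

corollary4p10 : (n : ℕ) (F : Fragment) → (compl ∈F F ⊎ minus ∈F F) → (k : ℕ) →
    (proj ∈F F → (inv ∈F F ⊎ OneAtDeg0 F) → SameBisim n F (remove proj F) k)
    × (lres ∈F F → inv ∈F F → OneAtDeg0 F → SameBisim n F (remove lres F) k)
    × (rres ∈F F → inv ∈F F → OneAtDeg0 F → SameBisim n F (remove rres F) k)
corollary4p10 n F _ k =
  (λ _ → sameBisim-remove-proj) ,
  (λ _ inv∈F total → sameBisim-of-inv-oneAtDeg0 {F′ = remove lres F} inv∈F inv∈F total
                       (oneAtDeg0-intro (remove lres F) (oneAtDeg0-elim F total)) (mk⇔ id id)) ,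
  (λ _ inv∈F total → sameBisim-of-inv-oneAtDeg0 {F′ = remove rres F} inv∈F inv∈F total
                       (oneAtDeg0-intro (remove rres F) (oneAtDeg0-elim F total)) (mk⇔ id id))
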